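{- Let $q$ be a prime power and $k\ge 1$ an integer. Then $$\mathcal{L}_q(k)=\frac{q^k-1}{q-1}+1,$$ where $\mathcal{L}_q(k)$ denotes the maximum, over all linear codes $C$ of dimension $k$ over $\mathbb{F}_q$ (of arbitrary length $n$), of the number of distinct values taken by the Hamming weight $\mathrm{wt}(c)$ as $c$ ranges over $C$ (the weight $0$ of the zero codeword included).
   Context: A linear $[n,k]_q$ code is a $k$-dimensional subspace of $\mathbb{F}_q^n$; the Hamming weight of a vector is its number of non-zero coordinates. The count of distinct weights includes the zero weight. -}

module Defs where

open import Level using (0ℓ)
open import Algebra.Bundles using (CommutativeRing)
open import Data.Nat using (ℕ; zero; suc; _≤_)
open import Data.Fin using (Fin; zero; suc)
open import Data.List using (List; length)
open import Data.List.Membership.Propositional using (_∈_)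
open import Data.List.Relation.Unary.Any using (Any)
open import Data.List.Relation.Unary.Unique.Propositional using (Unique)
open import Data.List.Relation.Unary.AllPairs using (AllPairs)
open import Data.Product using (Σ; _×_; ∃)
open import Relation.Nullary using (¬_; yes; no)
open import Relation.Binary.Definitions using (Decidable)
open import Relation.Binary.PropositionalEquality using (_≡_)
open import Function.Bundles using (_⇔_)

record FiniteField (q : ℕ) : Set₁ where
  field
    commRing : CommutativeRing 0ℓ 0ℓ
  open CommutativeRing commRing public
    using (Carrier; _≈_; 0#; 1#; _+_; _*_)
  field
    _≟_      : Decidable _≈_
    0≉1      : ¬ (0# ≈ 1#)
    inverse  : ∀ x → ¬ (x ≈ 0#) → Σ Carrier (λ y → x * y ≈ 1#)
    elements : List Carrier
    elements-length   : length elements ≡ q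
    elements-distinct : AllPairs (λ a b → ¬ (a ≈ b)) elements
    elements-complete : ∀ x → Any (x ≈_) elements

module _ {q : ℕ} (F : FiniteField q) where
  open FiniteField F using (Carrier; _≈_; _≟_; 0#; 1#; _+_; _*_)

  ∑ : ∀ {k} → (Fin k → Carrier) → Carrier
  ∑ {zero}  f = 0#
  ∑ {suc k} f = f zero + ∑ (λ i → f (suc i))

  wt : ∀ {n} → (Fin n → Carrier) → ℕ
  wt {zero}  c = 0
  wt {suc n} c with c zero ≟ 0#
  ... | yes _ = wt (λ j → c (suc j))
  ... | no  _ = suc (wt (λ j → c (suc j)))

  -- a k × n generator matrix G : its rows are linearly independent,
  -- so the code C = { m G : m ∈ F^k } is a k-dimensional subspace of F^n.
  LinearlyIndependentRows : ∀ {k n} → (Fin k → Fin n → Carrier) → Set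
  LinearlyIndependentRows {k} {n} G =
    ∀ (a : Fin k → Carrier) →
      (∀ j → ∑ (λ i → a i * G i j) ≈ 0#) → ∀ i → a i ≈ 0#

  encode : ∀ {k n} → (Fin k → Fin n → Carrier) → (Fin k → Carrier) → Fin n → Carrier
  encode G m j = ∑ (λ i → m i * G i j)

  IsWeightOf : ∀ {k n} → (Fin k → Fin n → Carrier) → ℕ → Set
  IsWeightOf G w = Σ _ (λ m → wt (encode G m) ≡ w)

  NumWeights : ∀ {k n} → (Fin k → Fin n → Carrier) → ℕ → Set
  NumWeights G s = Σ (List ℕ) λ l →
    Unique l × length l ≡ s × (∀ w → (w ∈ l) ⇔ IsWeightOf G w)

  IsMaxNumWeights : ℕ → ℕ → Set
  IsMaxNumWeights k L =
    (∀ n (G : Fin k → Fin n → Carrier) → LinearlyIndependentRows G →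
       ∀ s → NumWeights G s → s ≤ L)
    × Σ ℕ (λ n → Σ (Fin k → Fin n → Carrier) λ G →
         LinearlyIndependentRows G × NumWeights G L)

module Submission where

-- A non-zero message is a non-zero multiple of one of the (q^k - 1)/(q - 1) normalised
-- representatives of the points of PG(k-1, q), and scaling preserves weights; so a code of
-- dimension k has at most that many non-zero weights, plus the weight 0.
-- For the converse take functionals f₀, f₁, … that span the dual space, such that every point
-- is non-orthogonal to some fᵢ and any two points differ in which fᵢ vanish on them. The code
-- whose columns are the fᵢ, each repeated 2^i times, gives the message m the weight
-- ∑ᵢ [m · fᵢ ≠ 0] 2^i, a binary numeral; hence distinct points have distinct non-zero weights.

open import Defs
open import Data.Nat using (ℕ; _+_; _∸_; _^_; _≤_; NonZero)
open import Data.Nat.DivMod using (_/_)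

open import Algebra.Bundles using (CommutativeRing)
open import Data.Bool using (Bool; true; false)
open import Data.Fin using (Fin; zero; suc)
open import Data.Fin.Properties using (injective⇒≤; ¬∀⟶∃¬)
open import Data.List using (List; []; _∷_; _++_; [_]; map; length; lookup; allFin; cartesianProductWith)
open import Data.List.Properties using (length-++; length-map)
open import Data.List.Membership.Propositional using (_∈_)
open import Data.List.Membership.Propositional.Properties
  using (∈-lookup; ∈-map⁺; ∈-map⁻; ∈-++⁺ʳ; ∈-allFin)
open import Data.List.Relation.Binary.Subset.Propositional using (_⊆_)
open import Data.List.Relation.Unary.All as All using (All; []; _∷_)
import Data.List.Relation.Unary.All.Properties as All
open import Data.List.Relation.Unary.AllPairs using (AllPairs; []; _∷_)
import Data.List.Relation.Unary.AllPairs as AllPairs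
import Data.List.Relation.Unary.AllPairs.Properties as AllPairs
open import Data.List.Relation.Unary.Any as Any using (Any; here; there)
import Data.List.Relation.Unary.Any.Properties as Any
open import Data.List.Relation.Unary.Unique.Propositional using (Unique)
import Data.List.Relation.Unary.Unique.Setoid as Setoid
import Data.List.Relation.Unary.Unique.Setoid.Properties as Setoid
open import Data.Nat using (zero; suc; _*_)
open import Data.Nat.DivMod using (m*n/n≡m)
open import Data.Nat.Properties using (*-cancelˡ-≡; even≢odd; suc-injective)
import Data.Nat.Properties as ℕ
open import Data.Nat.Solver using (module +-*-Solver)
open import Data.Product using (Σ; _×_; _,_; proj₁; proj₂)
open import Data.Sum using (_⊎_; inj₁; inj₂)
open import Data.Vec.Functional using (Vector; tail; replicate) renaming ([] to []ᵥ; _∷_ to _∷ᵥ_)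
import Data.Vec.Functional.Relation.Binary.Equality.Setoid as VectorEquality
open import Function using (_∘_; flip)
open import Function.Bundles using (_⇔_; mk⇔; Equivalence)
open import Relation.Binary.PropositionalEquality as ≡ using (_≡_; _≢_; cong; subst)
import Relation.Binary.Reasoning.Setoid as SetoidReasoning
open import Relation.Nullary using (¬_; yes; no; does; contradiction)
open import Relation.Nullary.Decidable using (¬?; dec-true; dec-false; does-⇔)

private
  variable
    A B C : Set

Unique⇒lookup-injective : {xs : List A} → Unique xs →
  ∀ i j → lookup xs i ≡ lookup xs j → i ≡ j
Unique⇒lookup-injective (_ ∷ _)    zero    zero    _  = ≡.refl
Unique⇒lookup-injective (x∉ ∷ _)   zero    (suc j) eq =
  contradiction eq (All.lookup x∉ (∈-lookup j))
Unique⇒lookup-injective (x∉ ∷ _)   (suc i) zero    eq =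
  contradiction (≡.sym eq) (All.lookup x∉ (∈-lookup i))
Unique⇒lookup-injective (_ ∷ xs!)  (suc i) (suc j) eq = cong suc (Unique⇒lookup-injective xs! i j eq)

Unique∧⊆⇒length≤ : {xs ys : List A} → Unique xs → xs ⊆ ys → length xs ≤ length ys
Unique∧⊆⇒length≤ {xs = xs} {ys} xs! xs⊆ys = injective⇒≤ position-injective
  where
  position : Fin (length xs) → Fin (length ys)
  position i = Any.index (xs⊆ys (∈-lookup i))

  lookup-position : ∀ i → lookup xs i ≡ lookup ys (position i)
  lookup-position i = Any.lookup-index (xs⊆ys (∈-lookup i))

  position-injective : ∀ {i j} → position i ≡ position j → i ≡ j
  position-injective {i} {j} eq = Unique⇒lookup-injective xs! i j
    (≡.trans (lookup-position i) (≡.trans (cong (lookup ys) eq) (≡.sym (lookup-position j))))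

length-cartesianProductWith : ∀ (f : A → B → C) xs ys →
  length (cartesianProductWith f xs ys) ≡ length xs * length ys
length-cartesianProductWith f []       ys = ≡.refl
length-cartesianProductWith f (x ∷ xs) ys = ≡.trans (length-++ (map (f x) ys))
  (≡.cong₂ _+_ (length-map (f x) ys) (length-cartesianProductWith f xs ys))

fromColumns : ∀ {k} (cs : List (Vector A k)) → Fin k → Fin (length cs) → A
fromColumns cs i j = lookup cs j i

fromBits : List Bool → ℕ
fromBits []           = 0
fromBits (false ∷ bs) = 2 * fromBits bs
fromBits (true  ∷ bs) = 1 + 2 * fromBits bs

fromBits-∷-injective : ∀ {b c bs cs} → fromBits (b ∷ bs) ≡ fromBits (c ∷ cs) →
  b ≡ c × fromBits bs ≡ fromBits cs
fromBits-∷-injective {false} {false} {bs} {cs} eq =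
  ≡.refl , *-cancelˡ-≡ (fromBits bs) (fromBits cs) 2 eq
fromBits-∷-injective {true}  {true}  {bs} {cs} eq =
  ≡.refl , *-cancelˡ-≡ (fromBits bs) (fromBits cs) 2 (suc-injective eq)
fromBits-∷-injective {false} {true}  {bs} {cs} eq =
  contradiction eq (even≢odd (fromBits bs) (fromBits cs))
fromBits-∷-injective {true}  {false} {bs} {cs} eq =
  contradiction (≡.sym eq) (even≢odd (fromBits cs) (fromBits bs))

fromBits-map-≢ : ∀ {g h : A → Bool} {xs} → Any (λ x → g x ≢ h x) xs →
  fromBits (map g xs) ≢ fromBits (map h xs)
fromBits-map-≢ {g = g} {h} {x ∷ xs} (here gx≢hx) =
  gx≢hx ∘ proj₁ ∘ fromBits-∷-injective {g x} {h x} {map g xs} {map h xs}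
fromBits-map-≢ {g = g} {h} {x ∷ xs} (there gxs≢hxs) =
  fromBits-map-≢ gxs≢hxs ∘ proj₂ ∘ fromBits-∷-injective {g x} {h x} {map g xs} {map h xs}

fromBits-∷≡0 : ∀ {b bs} → fromBits (b ∷ bs) ≡ 0 → fromBits bs ≡ 0
fromBits-∷≡0 {false} {bs} eq = *-cancelˡ-≡ (fromBits bs) 0 2 eq

fromBits-map-≢0 : ∀ {g : A → Bool} {xs} → Any (λ x → g x ≡ true) xs → fromBits (map g xs) ≢ 0
fromBits-map-≢0 (here gx≡true) rewrite gx≡true = λ ()
fromBits-map-≢0 {g = g} {x ∷ xs} (there any) = fromBits-map-≢0 any ∘ fromBits-∷≡0 {g x} {map g xs}

m≡n⇒m+m≡2*n : ∀ {m n} → m ≡ n → m + m ≡ 2 * n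
m≡n⇒m+m≡2*n {n = n} ≡.refl = cong (n +_) (≡.sym (ℕ.+-identityʳ n))

-- The i-th entry of xs occurs 2^i times in binaryReplicate xs.
binaryReplicate : List A → List A
binaryReplicate []       = []
binaryReplicate (x ∷ xs) = x ∷ binaryReplicate xs ++ binaryReplicate xs

∈-binaryReplicate : ∀ {x} {xs : List A} → x ∈ xs → x ∈ binaryReplicate xs
∈-binaryReplicate (here x≡y)  = here x≡y
∈-binaryReplicate (there x∈)  = there (Any.++⁺ˡ (∈-binaryReplicate x∈))

-- The number of points of PG(k-1, b).
repunit : ℕ → ℕ → ℕ
repunit b zero    = 0
repunit b (suc k) = b ^ k + repunit b k

[1+r]^k≡1+repunit*r : ∀ r k → suc r ^ k ≡ suc (repunit (suc r) k * r)
[1+r]^k≡1+repunit*r r zero    = ≡.refl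
[1+r]^k≡1+repunit*r r (suc k) rewrite [1+r]^k≡1+repunit*r r k =
  solve 2 (λ R r → (con 1 :+ r) :* (con 1 :+ R :* r) := con 1 :+ (con 1 :+ R :* r :+ R) :* r)
    ≡.refl (repunit (suc r) k) r
  where open +-*-Solver

[[1+r]^k∸1]/r+1≡1+repunit : ∀ r k .{{_ : NonZero r}} →
  (suc r ^ k ∸ 1) / r + 1 ≡ suc (repunit (suc r) k)
[[1+r]^k∸1]/r+1≡1+repunit r k = ≡.trans
  (cong (λ n → (n ∸ 1) / r + 1) ([1+r]^k≡1+repunit*r r k))
  (≡.trans (cong (_+ 1) (m*n/n≡m (repunit (suc r) k) r)) (ℕ.+-comm _ 1))

module _ {q : ℕ} (F : FiniteField q) where

  open FiniteField F renaming (_+_ to _⊕_; _*_ to _⊗_)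
  open CommutativeRing commRing using (-_; semiring; setoid; refl; sym; trans;
    +-cong; +-congˡ; +-congʳ; +-assoc; +-identityˡ; +-identityʳ; -‿inverseˡ; -‿inverseʳ;
    *-congˡ; *-congʳ; *-assoc; *-comm; *-identityˡ; *-identityʳ; zeroˡ; zeroʳ)
  open import Algebra.Properties.Semiring.Sum semiring
    using (sum; sum-cong-≋; sum-replicate-zero; *-distribˡ-sum)
  open VectorEquality setoid using (_≋_; ≋-setoid)
  open SetoidReasoning setoid

  𝔽^_ : ℕ → Set
  𝔽^ k = Vector Carrier k

  Matrix : ℕ → ℕ → Set
  Matrix k n = Fin k → Fin n → Carrier

  1≉0 : ¬ (1# ≈ 0#)
  1≉0 = 0≉1 ∘ sym

  a≉0∧a*x≈0⇒x≈0 : ∀ {a x} → ¬ (a ≈ 0#) → a ⊗ x ≈ 0# → x ≈ 0#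
  a≉0∧a*x≈0⇒x≈0 {a} {x} a≉0 ax≈0 with inverse a a≉0
  ... | a⁻¹ , aa⁻¹≈1 = begin
    x               ≈⟨ *-identityˡ x ⟨
    1# ⊗ x          ≈⟨ *-congʳ (trans (*-comm a⁻¹ a) aa⁻¹≈1) ⟨
    a⁻¹ ⊗ a ⊗ x     ≈⟨ *-assoc a⁻¹ a x ⟩
    a⁻¹ ⊗ (a ⊗ x)   ≈⟨ *-congˡ ax≈0 ⟩
    a⁻¹ ⊗ 0#        ≈⟨ zeroʳ a⁻¹ ⟩
    0#              ∎

  -c+x≈0⇒x≈c : ∀ {c x} → (- c) ⊕ x ≈ 0# → x ≈ c
  -c+x≈0⇒x≈c {c} {x} -c+x≈0 = begin
    x                 ≈⟨ +-identityˡ x ⟨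
    0# ⊕ x            ≈⟨ +-congʳ (-‿inverseʳ c) ⟨
    c ⊕ (- c) ⊕ x     ≈⟨ +-assoc c (- c) x ⟩
    c ⊕ ((- c) ⊕ x)   ≈⟨ +-congˡ -c+x≈0 ⟩
    c ⊕ 0#            ≈⟨ +-identityʳ c ⟩
    c                 ∎

  ∑≡sum : ∀ {k} (f : 𝔽^ k) → ∑ F f ≡ sum f
  ∑≡sum {zero}  f = ≡.refl
  ∑≡sum {suc k} f = cong (f zero ⊕_) (∑≡sum (tail f))

  ∑≈0 : ∀ {k} {f : 𝔽^ k} → (∀ i → f i ≈ 0#) → ∑ F f ≈ 0#
  ∑≈0 {k} {f} f≈0 = begin
    ∑ F f                ≡⟨ ∑≡sum f ⟩
    sum f                ≈⟨ sum-cong-≋ f≈0 ⟩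
    sum (replicate k 0#) ≈⟨ sum-replicate-zero k ⟩
    0#                   ∎

  infix 7 _·_
  _·_ : ∀ {k} → 𝔽^ k → 𝔽^ k → Carrier
  x · y = ∑ F (λ i → x i ⊗ y i)

  ·-scaleˡ : ∀ {k} {x p y : 𝔽^ k} a → (∀ i → x i ≈ a ⊗ p i) → x · y ≈ a ⊗ (p · y)
  ·-scaleˡ {x = x} {p} {y} a x≈ap = begin
    x · y                         ≡⟨ ∑≡sum (λ i → x i ⊗ y i) ⟩
    sum (λ i → x i ⊗ y i)         ≈⟨ sum-cong-≋ (λ i → *-congʳ (x≈ap i)) ⟩
    sum (λ i → a ⊗ p i ⊗ y i)     ≈⟨ sum-cong-≋ (λ i → *-assoc a (p i) (y i)) ⟩
    sum (λ i → a ⊗ (p i ⊗ y i))   ≈⟨ *-distribˡ-sum a (λ i → p i ⊗ y i) ⟨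
    a ⊗ sum (λ i → p i ⊗ y i)     ≡⟨ cong (a ⊗_) (∑≡sum (λ i → p i ⊗ y i)) ⟨
    a ⊗ (p · y)                   ∎

  ∷-·-0∷ : ∀ {k} x (u v : 𝔽^ k) → (x ∷ᵥ u) · (0# ∷ᵥ v) ≈ u · v
  ∷-·-0∷ x u v = trans (+-congʳ (zeroʳ x)) (+-identityˡ (u · v))

  unitVector : ∀ {k} → Fin k → 𝔽^ k
  unitVector zero    = 1# ∷ᵥ replicate _ 0#
  unitVector (suc j) = 0# ∷ᵥ unitVector j

  ·-unitVector : ∀ {k} (x : 𝔽^ k) j → x · unitVector j ≈ x j
  ·-unitVector x zero    =
    trans (+-cong (*-identityʳ (x zero)) (∑≈0 (λ i → zeroʳ (x (suc i))))) (+-identityʳ (x zero))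
  ·-unitVector x (suc j) = trans (∷-·-0∷ (x zero) (tail x) (unitVector j)) (·-unitVector (tail x) j)

  isNonZero : Carrier → Bool
  isNonZero x = does (¬? (x ≟ 0#))

  ≉0⇒isNonZero≡true : ∀ {x} → ¬ (x ≈ 0#) → isNonZero x ≡ true
  ≉0⇒isNonZero≡true {x} = dec-true (¬? (x ≟ 0#))

  ≈0⇒isNonZero≡false : ∀ {x} → x ≈ 0# → isNonZero x ≡ false
  ≈0⇒isNonZero≡false {x} x≈0 = dec-false (¬? (x ≟ 0#)) (λ x≉0 → x≉0 x≈0)

  isNonZero-cong : ∀ {x y} → x ≈ y → isNonZero x ≡ isNonZero y
  isNonZero-cong {x} {y} x≈y = does-⇔
    (mk⇔ (λ x≉0 y≈0 → x≉0 (trans x≈y y≈0))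
         (λ y≉0 x≈0 → y≉0 (trans (sym x≈y) x≈0)))
    (¬? (x ≟ 0#)) (¬? (y ≟ 0#))

  isNonZero-≢ : ∀ {x y} → x ≈ 0# → ¬ (y ≈ 0#) → isNonZero x ≢ isNonZero y
  isNonZero-≢ x≈0 y≉0 rewrite ≈0⇒isNonZero≡false x≈0 | ≉0⇒isNonZero≡true y≉0 = λ ()

  wt-cong-zeros : ∀ {n} {c d : 𝔽^ n} → (∀ j → (c j ≈ 0#) ⇔ (d j ≈ 0#)) → wt F c ≡ wt F d
  wt-cong-zeros {zero}  _ = ≡.refl
  wt-cong-zeros {suc n} {c} {d} c⇔d with c zero ≟ 0# | d zero ≟ 0#
  ... | yes _    | yes _    = wt-cong-zeros (c⇔d ∘ suc)
  ... | no  _    | no  _    = cong suc (wt-cong-zeros (c⇔d ∘ suc))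
  ... | yes c₀≈0 | no  d₀≉0 = contradiction (Equivalence.to (c⇔d zero) c₀≈0) d₀≉0
  ... | no  c₀≉0 | yes d₀≈0 = contradiction (Equivalence.from (c⇔d zero) d₀≈0) c₀≉0

  wt-zero : ∀ {n} {c : 𝔽^ n} → (∀ j → c j ≈ 0#) → wt F c ≡ 0
  wt-zero {zero}  _ = ≡.refl
  wt-zero {suc n} {c} c≈0 with c zero ≟ 0#
  ... | yes _    = wt-zero (c≈0 ∘ suc)
  ... | no c₀≉0  = contradiction (c≈0 zero) c₀≉0

  weight : ∀ {k n} → Matrix k n → 𝔽^ k → ℕ
  weight G m = wt F (encode F G m)

  weight-zero : ∀ {k n} (G : Matrix k n) {m} → (∀ i → m i ≈ 0#) → weight G m ≡ 0
  weight-zero G m≈0 = wt-zero (λ j → ∑≈0 (λ i → trans (*-congʳ (m≈0 i)) (zeroˡ (G i j))))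

  weight-fromColumns-++ : ∀ {k} (m : 𝔽^ k) cs ds →
    weight (fromColumns (cs ++ ds)) m ≡ weight (fromColumns cs) m + weight (fromColumns ds) m
  weight-fromColumns-++ m []       ds = ≡.refl
  weight-fromColumns-++ m (c ∷ cs) ds with (m · c) ≟ 0#
  ... | yes _ = weight-fromColumns-++ m cs ds
  ... | no  _ = cong suc (weight-fromColumns-++ m cs ds)

  weight-fromColumns-binaryReplicate : ∀ {k} (m : 𝔽^ k) fs →
    weight (fromColumns (binaryReplicate fs)) m ≡ fromBits (map (λ f → isNonZero (m · f)) fs)
  weight-fromColumns-binaryReplicate m []       = ≡.refl
  weight-fromColumns-binaryReplicate m (f ∷ fs) with (m · f) ≟ 0#
  ... | yes _ = ≡.trans (weight-fromColumns-++ m (binaryReplicate fs) (binaryReplicate fs))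
                        (m≡n⇒m+m≡2*n (weight-fromColumns-binaryReplicate m fs))
  ... | no  _ = cong suc (≡.trans (weight-fromColumns-++ m (binaryReplicate fs) (binaryReplicate fs))
                                  (m≡n⇒m+m≡2*n (weight-fromColumns-binaryReplicate m fs)))

  vectors : ∀ k → List (𝔽^ k)
  vectors zero    = [ []ᵥ ]
  vectors (suc k) = cartesianProductWith _∷ᵥ_ elements (vectors k)

  length-vectors : ∀ k → length (vectors k) ≡ q ^ k
  length-vectors zero    = ≡.refl
  length-vectors (suc k) = ≡.trans (length-cartesianProductWith _∷ᵥ_ elements (vectors k))
    (≡.cong₂ _*_ elements-length (length-vectors k))

  vectors-complete : ∀ k (v : 𝔽^ k) → Any (v ≋_) (vectors k)
  vectors-complete zero    v = here (λ ())
  vectors-complete (suc k) v = Any.cartesianProductWith⁺ _∷ᵥ_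
    (λ v₀≈a v'≋u → λ { zero → v₀≈a ; (suc i) → v'≋u i })
    (elements-complete (v zero)) (vectors-complete k (tail v))

  vectors-unique : ∀ k → Setoid.Unique (≋-setoid k) (vectors k)
  vectors-unique zero    = [] ∷ []
  vectors-unique (suc k) =
    Setoid.cartesianProductWith⁺ setoid (≋-setoid k) (≋-setoid (suc k)) _∷ᵥ_
      (λ ∷≋∷ → ∷≋∷ zero , ∷≋∷ ∘ suc) elements-distinct (vectors-unique k)

  -- One representative, with first non-zero coordinate 1#, of each point of PG(k-1, q).
  projectivePoints : ∀ k → List (𝔽^ k)
  projectivePoints zero    = []
  projectivePoints (suc k) = map (1# ∷ᵥ_) (vectors k) ++ map (0# ∷ᵥ_) (projectivePoints k)

  length-projectivePoints : ∀ k → length (projectivePoints k) ≡ repunit q k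
  length-projectivePoints zero    = ≡.refl
  length-projectivePoints (suc k) = ≡.trans (length-++ (map (1# ∷ᵥ_) (vectors k)))
    (≡.cong₂ _+_ (≡.trans (length-map (1# ∷ᵥ_) (vectors k)) (length-vectors k))
                 (≡.trans (length-map (0# ∷ᵥ_) (projectivePoints k)) (length-projectivePoints k)))

  _IsMultipleOf_ : ∀ {k} → 𝔽^ k → 𝔽^ k → Set
  m IsMultipleOf p = Σ Carrier λ a → ¬ (a ≈ 0#) × (∀ i → m i ≈ a ⊗ p i)

  IsMultipleOf-0∷ : ∀ {k} {m : 𝔽^ (suc k)} {p} → m zero ≈ 0# → tail m IsMultipleOf p →
    m IsMultipleOf (0# ∷ᵥ p)
  IsMultipleOf-0∷ m₀≈0 (a , a≉0 , m'≈ap) = a , a≉0 , λ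
    { zero    → trans m₀≈0 (sym (zeroʳ a))
    ; (suc i) → m'≈ap i }

  IsMultipleOf-1∷ : ∀ {k} (m : 𝔽^ (suc k)) → ¬ (m zero ≈ 0#) →
    Any (m IsMultipleOf_) (map (1# ∷ᵥ_) (vectors k))
  IsMultipleOf-1∷ {k} m m₀≉0 =
    Any.map⁺ (Any.map normalised (vectors-complete k (λ i → m₀⁻¹ ⊗ m (suc i))))
    where
    m₀⁻¹ : Carrier
    m₀⁻¹ = proj₁ (inverse (m zero) m₀≉0)

    normalised : ∀ {u} → (λ i → m₀⁻¹ ⊗ m (suc i)) ≋ u → m IsMultipleOf (1# ∷ᵥ u)
    normalised {u} m₀⁻¹m'≋u = m zero , m₀≉0 , λ
      { zero    → sym (*-identityʳ (m zero))
      ; (suc i) → begin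
          m (suc i)                   ≈⟨ *-identityˡ (m (suc i)) ⟨
          1# ⊗ m (suc i)              ≈⟨ *-congʳ (proj₂ (inverse (m zero) m₀≉0)) ⟨
          m zero ⊗ m₀⁻¹ ⊗ m (suc i)   ≈⟨ *-assoc (m zero) m₀⁻¹ (m (suc i)) ⟩
          m zero ⊗ (m₀⁻¹ ⊗ m (suc i)) ≈⟨ *-congˡ (m₀⁻¹m'≋u i) ⟩
          m zero ⊗ u i                ∎ }

  zero⊎multipleOfProjectivePoint : ∀ k (m : 𝔽^ k) →
    (∀ i → m i ≈ 0#) ⊎ Any (m IsMultipleOf_) (projectivePoints k)
  zero⊎multipleOfProjectivePoint zero    m = inj₁ (λ ())
  zero⊎multipleOfProjectivePoint (suc k) m with m zero ≟ 0#
  ... | no  m₀≉0 = inj₂ (Any.++⁺ˡ (IsMultipleOf-1∷ m m₀≉0))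
  ... | yes m₀≈0 with zero⊎multipleOfProjectivePoint k (tail m)
  ...   | inj₁ m'≈0     = inj₁ λ { zero → m₀≈0 ; (suc i) → m'≈0 i }
  ...   | inj₂ multiple = inj₂ (Any.++⁺ʳ (map (1# ∷ᵥ_) (vectors k))
                                         (Any.map⁺ (Any.map (IsMultipleOf-0∷ m₀≈0) multiple)))

  weight-scale : ∀ {k n} (G : Matrix k n) {m p} → m IsMultipleOf p →
    weight G m ≡ weight G p
  weight-scale G (a , a≉0 , m≈ap) = wt-cong-zeros λ j →
    let mGj≈a[pGj] = ·-scaleˡ {y = λ i → G i j} a m≈ap in
    mk⇔ (λ mGj≈0 → a≉0∧a*x≈0⇒x≈0 a≉0 (trans (sym mGj≈a[pGj]) mGj≈0))
        (λ pGj≈0 → trans mGj≈a[pGj] (trans (*-congˡ pGj≈0) (zeroʳ a)))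

  weightCandidates : ∀ {k n} → Matrix k n → List ℕ
  weightCandidates {k} G = 0 ∷ map (weight G) (projectivePoints k)

  length-weightCandidates : ∀ {k n} (G : Matrix k n) → length (weightCandidates G) ≡ 1 + repunit q k
  length-weightCandidates {k} G =
    cong suc (≡.trans (length-map (weight G) (projectivePoints k)) (length-projectivePoints k))

  weight∈weightCandidates : ∀ {k n} (G : Matrix k n) m → weight G m ∈ weightCandidates G
  weight∈weightCandidates {k} G m with zero⊎multipleOfProjectivePoint k m
  ... | inj₁ m≈0      = here (weight-zero G m≈0)
  ... | inj₂ multiple = there (Any.map⁺ (Any.map (weight-scale G) multiple))

  ∈weightCandidates⇒IsWeightOf : ∀ {k n} (G : Matrix k n) {w} →
    w ∈ weightCandidates G → IsWeightOf F G w
  ∈weightCandidates⇒IsWeightOf G (here w≡0) =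
    (λ _ → 0#) , ≡.trans (weight-zero G (λ _ → refl)) (≡.sym w≡0)
  ∈weightCandidates⇒IsWeightOf G (there w∈) with ∈-map⁻ (weight G) w∈
  ... | p , _ , w≡Wp = p , ≡.sym w≡Wp

  IsWeightOf⇒∈weightCandidates : ∀ {k n} (G : Matrix k n) {w} →
    IsWeightOf F G w → w ∈ weightCandidates G
  IsWeightOf⇒∈weightCandidates G (m , ≡.refl) = weight∈weightCandidates G m

  numWeights≤ : ∀ {k n} (G : Matrix k n) {s} → NumWeights F G s → s ≤ 1 + repunit q k
  numWeights≤ G (ws , ws! , ≡.refl , ws⇔) = subst (length ws ≤_) (length-weightCandidates G)
    (Unique∧⊆⇒length≤ ws! (IsWeightOf⇒∈weightCandidates G ∘ Equivalence.to (ws⇔ _)))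

  numWeights-weightCandidates : ∀ {k n} (G : Matrix k n) → Unique (weightCandidates G) →
    NumWeights F G (1 + repunit q k)
  numWeights-weightCandidates G candidates! = weightCandidates G , candidates! , length-weightCandidates G ,
    λ _ → mk⇔ (∈weightCandidates⇒IsWeightOf G) (IsWeightOf⇒∈weightCandidates G)

  Separates : ∀ {k} → 𝔽^ k → 𝔽^ k → 𝔽^ k → Set
  Separates p p' f = isNonZero (p · f) ≢ isNonZero (p' · f)

  -- e₀ vanishes exactly on the points starting with 0#, and - c e₀ + e_{j+1} vanishes on 1# ∷ u
  -- exactly when u j ≈ c; the shifted separators of dimension k handle the points starting with 0#.
  separators : ∀ k → List (𝔽^ k)
  separators zero    = []
  separators (suc k) = unitVector zero
    ∷ cartesianProductWith (λ j c → (- c) ∷ᵥ unitVector j) (allFin k) elements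
    ++ map (0# ∷ᵥ_) (separators k)

  ∈-separators-shift : ∀ {k} {f : 𝔽^ k} → f ∈ separators k → (0# ∷ᵥ f) ∈ separators (suc k)
  ∈-separators-shift = there ∘ ∈-++⁺ʳ _ ∘ ∈-map⁺ (0# ∷ᵥ_)

  Any-separators-shift : ∀ {k} {P : 𝔽^ (suc k) → Set} {Q : 𝔽^ k → Set} →
    (∀ {f} → Q f → P (0# ∷ᵥ f)) → Any Q (separators k) → Any P (separators (suc k))
  Any-separators-shift Q⇒P = there ∘ Any.++⁺ʳ _ ∘ Any.map⁺ ∘ Any.map Q⇒P

  1∷u·e₀≉0 : ∀ {k} (u : 𝔽^ k) → ¬ ((1# ∷ᵥ u) · unitVector zero ≈ 0#)
  1∷u·e₀≉0 u ≈0 = 1≉0 (trans (sym (·-unitVector (1# ∷ᵥ u) zero)) ≈0)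

  1∷u·-c∷eⱼ≈-c+uⱼ : ∀ {k} (u : 𝔽^ k) c j →
    (1# ∷ᵥ u) · ((- c) ∷ᵥ unitVector j) ≈ (- c) ⊕ u j
  1∷u·-c∷eⱼ≈-c+uⱼ u c j = +-cong (*-identityˡ (- c)) (·-unitVector u j)

  Separates-0∷ : ∀ {k} {p p' f : 𝔽^ k} → Separates p p' f →
    Separates (0# ∷ᵥ p) (0# ∷ᵥ p') (0# ∷ᵥ f)
  Separates-0∷ {p = p} {p'} {f} separated = separated
    ∘ ≡.trans (≡.sym (isNonZero-cong (∷-·-0∷ 0# p f)))
    ∘ flip ≡.trans (isNonZero-cong (∷-·-0∷ 0# p' f))

  Separates-1∷-0∷ : ∀ {k} (u p : 𝔽^ k) → Separates (1# ∷ᵥ u) (0# ∷ᵥ p) (unitVector zero)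
  Separates-1∷-0∷ u p = isNonZero-≢ (·-unitVector (0# ∷ᵥ p) zero) (1∷u·e₀≉0 u) ∘ ≡.sym

  Separates-1∷ : ∀ {k} {u v : 𝔽^ k} → ¬ (u ≋ v) →
    Any (Separates (1# ∷ᵥ u) (1# ∷ᵥ v)) (separators (suc k))
  Separates-1∷ {k} {u} {v} u≉v with ¬∀⟶∃¬ k (λ j → u j ≈ v j) (λ j → u j ≟ v j) u≉v
  ... | j , uⱼ≉vⱼ = there (Any.++⁺ˡ
        (Any.cartesianProductWith⁺ _ separated (∈-allFin j) (elements-complete (u j))))
    where
    separated : ∀ {j' c} → j ≡ j' → u j ≈ c →
      Separates (1# ∷ᵥ u) (1# ∷ᵥ v) ((- c) ∷ᵥ unitVector j')
    separated {c = c} ≡.refl uⱼ≈c = isNonZero-≢ u-orthogonal v-not-orthogonal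
      where
      u-orthogonal : (1# ∷ᵥ u) · ((- c) ∷ᵥ unitVector j) ≈ 0#
      u-orthogonal = trans (1∷u·-c∷eⱼ≈-c+uⱼ u c j) (trans (+-congˡ uⱼ≈c) (-‿inverseˡ c))

      v-not-orthogonal : ¬ ((1# ∷ᵥ v) · ((- c) ∷ᵥ unitVector j) ≈ 0#)
      v-not-orthogonal ≈0 = uⱼ≉vⱼ (trans uⱼ≈c
        (sym (-c+x≈0⇒x≈c (trans (sym (1∷u·-c∷eⱼ≈-c+uⱼ v c j)) ≈0))))

  separators-detect : ∀ k →
    All (λ p → Any (λ f → isNonZero (p · f) ≡ true) (separators k)) (projectivePoints k)
  separators-detect zero    = []
  separators-detect (suc k) = All.++⁺
    (All.map⁺ (All.universal (λ u → here (≉0⇒isNonZero≡true (1∷u·e₀≉0 u))) (vectors k)))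
    (All.map⁺ (All.map (Any-separators-shift λ {f} → ≡.trans (isNonZero-cong (∷-·-0∷ 0# _ f)))
                       (separators-detect k)))

  separators-separate : ∀ k →
    AllPairs (λ p p' → Any (Separates p p') (separators k)) (projectivePoints k)
  separators-separate zero    = []
  separators-separate (suc k) = AllPairs.++⁺
    (AllPairs.map⁺ (AllPairs.map Separates-1∷ (vectors-unique k)))
    (AllPairs.map⁺ (AllPairs.map (Any-separators-shift (Separates-0∷ {k})) (separators-separate k)))
    (All.map⁺ (All.universal (λ u → All.map⁺ (All.universal (here ∘ Separates-1∷-0∷ u) _))
                             (vectors k)))

  separators-orthogonal⇒≈0 : ∀ k {a : 𝔽^ k} →
    (∀ {f} → f ∈ separators k → a · f ≈ 0#) → ∀ i → a i ≈ 0#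
  separators-orthogonal⇒≈0 (suc k) {a} a⊥ zero    =
    trans (sym (·-unitVector a zero)) (a⊥ (here ≡.refl))
  separators-orthogonal⇒≈0 (suc k) {a} a⊥ (suc i) = separators-orthogonal⇒≈0 k
    (λ {f} f∈ → trans (sym (∷-·-0∷ (a zero) (tail a) f)) (a⊥ (∈-separators-shift f∈))) i

  fromColumns-independent : ∀ {k} (cs : List (𝔽^ k)) →
    (∀ {a} → (∀ {c} → c ∈ cs → a · c ≈ 0#) → ∀ i → a i ≈ 0#) →
    LinearlyIndependentRows F (fromColumns cs)
  fromColumns-independent cs independent a a⊥ = independent λ c∈ →
    subst (λ c → a · c ≈ 0#) (≡.sym (Any.lookup-index c∈)) (a⊥ (Any.index c∈))

  separatorCode : ∀ k → Matrix k (length (binaryReplicate (separators k)))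
  separatorCode k = fromColumns (binaryReplicate (separators k))

  separatorCode-independent : ∀ k → LinearlyIndependentRows F (separatorCode k)
  separatorCode-independent k = fromColumns-independent (binaryReplicate (separators k))
    (λ a⊥ → separators-orthogonal⇒≈0 k (a⊥ ∘ ∈-binaryReplicate))

  weightCandidates-separatorCode-unique : ∀ k → Unique (weightCandidates (separatorCode k))
  weightCandidates-separatorCode-unique k =
    All.map⁺ (All.map weight≢0 (separators-detect k))
    ∷ AllPairs.map⁺ (AllPairs.map weights≢ (separators-separate k))
    where
    W : 𝔽^ k → ℕ
    W = weight (separatorCode k)

    W≡fromBits : ∀ p → W p ≡ fromBits (map (λ f → isNonZero (p · f)) (separators k))
    W≡fromBits p = weight-fromColumns-binaryReplicate p (separators k)

    weight≢0 : ∀ {p} → Any (λ f → isNonZero (p · f) ≡ true) (separators k) → 0 ≢ W p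
    weight≢0 {p} detected 0≡Wp =
      fromBits-map-≢0 detected (≡.trans (≡.sym (W≡fromBits p)) (≡.sym 0≡Wp))

    weights≢ : ∀ {p p'} → Any (Separates p p') (separators k) → W p ≢ W p'
    weights≢ {p} {p'} separated Wp≡Wp' =
      fromBits-map-≢ separated (≡.trans (≡.sym (W≡fromBits p)) (≡.trans Wp≡Wp' (W≡fromBits p')))

theorem1 : (q : ℕ) .{{_ : NonZero (q ∸ 1)}} (F : FiniteField q) (k : ℕ) →
    1 ≤ k → IsMaxNumWeights F k ((q ^ k ∸ 1) / (q ∸ 1) + 1)
theorem1 (suc r) {{r≢0}} F k _ rewrite [[1+r]^k∸1]/r+1≡1+repunit r k {{r≢0}} =
  (λ _ G _ _ → numWeights≤ F G) ,
  (_ , separatorCode F k , separatorCode-independent F k ,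
   numWeights-weightCandidates F (separatorCode F k) (weightCandidates-separatorCode-unique F k))
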